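{- Let $\mathcal{G}$ be an additive subgroup of $\mathbb{R}$, $n$ a positive integer, and $c,m\in\mathcal{G}$ with $c>0$, $m\geq 0$. Each equivalence class of the relation $\sim$ on $S$ is finite.
   Context: An area vector is $g=(g_0,\ldots,g_{n-1})\in\mathcal{G}^n$ with $g_{i+1}\leq g_i+m$ for $0\leq i<n-1$; $\mathrm{AV}_n$ is the set of area vectors. The cycling operator $C:\mathcal{G}^n\to\mathcal{G}^n$ is $C(g_0,\ldots,g_{n-1})=(g_1,\ldots,g_{n-1},g_0-c)$, a bijection with powers $C^j$, $j\in\mathbb{Z}$. $S=\{g\in\mathrm{AV}_n: g_0\leq c,\ g_{n-1}>0\}$, and for $g,h\in S$, $g\sim h$ iff $h=C^j(g)$ for some $j\in\mathbb{Z}$. -}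

module Defs where

open import Data.Nat using (ℕ; zero; suc)
open import Data.Integer using (ℤ; +_; -[1+_])
open import Data.Fin using (Fin; inject₁) renaming (suc to fsuc)
open import Data.Vec using (Vec; _∷_; []; _∷ʳ_; lookup; last; init; head)
open import Data.Product using (Σ; _×_; ∃)
open import Data.List using (List)
open import Data.List.Membership.Propositional using (_∈_)
open import Relation.Nullary using (¬_)
open import Relation.Binary.PropositionalEquality using (_≡_)
open import Relation.Binary.Structures using (IsTotalOrder)
open import Algebra.Structures using (IsAbelianGroup)

lt : {A : Set} → (A → A → Set) → A → A → Set
lt _≤_ x y = x ≤ y × ¬ (x ≡ y)

mulℕ : {A : Set} → (A → A → A) → A → ℕ → A → A
mulℕ _+_ 0# zero x = 0#
mulℕ _+_ 0# (suc n) x = x + mulℕ _+_ 0# n x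

-- An archimedean totally ordered abelian group.  By Hölder's theorem these are
-- exactly (up to isomorphism) the additive subgroups of ℝ.
record ArchGroup : Set₁ where
  infixl 6 _+_
  infix 4 _≤_
  field
    Carrier : Set
    _+_ : Carrier → Carrier → Carrier
    0# : Carrier
    -_ : Carrier → Carrier
    _≤_ : Carrier → Carrier → Set
    isAbelianGroup : IsAbelianGroup _≡_ _+_ 0# -_
    isTotalOrder : IsTotalOrder _≡_ _≤_
    +-monoˡ-≤ : ∀ {x y} z → x ≤ y → x + z ≤ y + z
    archimedean : ∀ x y → lt _≤_ 0# x → ∃ λ (n : ℕ) → y ≤ mulℕ _+_ 0# n x

  _-_ : Carrier → Carrier → Carrier
  x - y = x + (- y)

  _<_ : Carrier → Carrier → Set
  _<_ = lt _≤_

  _·ℕ_ : ℕ → Carrier → Carrier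
  _·ℕ_ = mulℕ _+_ 0#

module _ (G : ArchGroup) (c m : ArchGroup.Carrier G) where
  open ArchGroup G

  -- area vectors of length n = suc k: g (i+1) ≤ g i + m for 0 ≤ i < n-1
  IsAreaVector : ∀ {k} → Vec Carrier (suc k) → Set
  IsAreaVector {k} g = ∀ (i : Fin k) → lookup g (fsuc i) ≤ lookup g (inject₁ i) + m

  cyc : ∀ {k} → Vec Carrier (suc k) → Vec Carrier (suc k)
  cyc (x ∷ xs) = xs ∷ʳ (x - c)

  cyc⁻¹ : ∀ {k} → Vec Carrier (suc k) → Vec Carrier (suc k)
  cyc⁻¹ g = (last g + c) ∷ init g

  iterN : ∀ {A : Set} → (A → A) → ℕ → A → A
  iterN f zero a = a
  iterN f (suc n) a = f (iterN f n a)

  cycPow : ∀ {k} → ℤ → Vec Carrier (suc k) → Vec Carrier (suc k)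
  cycPow (+ n) g = iterN cyc n g
  cycPow -[1+ n ] g = iterN cyc⁻¹ (suc n) g

  InS : ∀ {k} → Vec Carrier (suc k) → Set
  InS g = IsAreaVector g × (head g ≤ c) × (0# < last g)

  _∼_ : ∀ {k} → Vec Carrier (suc k) → Vec Carrier (suc k) → Set
  g ∼ h = InS g × InS h × ∃ λ (j : ℤ) → h ≡ cycPow j g

  ClassFinite : ∀ {k} → Vec Carrier (suc k) → Set
  ClassFinite {k} g = Σ (List (Vec Carrier (suc k))) λ L → ∀ h → g ∼ h → h ∈ L

{-# OPTIONS --safe #-}
-- Cycling lowers the sum of the entries by c, so the entries of C^j g sum to
-- Σ g − j·c.  On S this sum is bounded on both sides: going down the vector from
-- g₀ ≤ c each entry grows by at most m, and going up from g_{n-1} > 0 each entry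
-- drops by at most m.  Since the group is archimedean, only finitely many j can
-- then have C^j g ∈ S.
module Submission where

open import Defs
open import Algebra.Bundles using (AbelianGroup)
import Algebra.Properties.AbelianGroup as AbelianGroupProperties
open import Data.Empty using (⊥-elim)
open import Data.Integer using (ℤ; ∣_∣)
import Data.Integer as ℤ
open import Data.List using (List; applyUpTo; _++_)
open import Data.List.Membership.Propositional using (_∈_)
open import Data.List.Membership.Propositional.Properties using (∈-applyUpTo⁺; ∈-++⁺ˡ; ∈-++⁺ʳ)
open import Data.Fin using () renaming (zero to fzero; suc to fsuc)
open import Data.Nat using (ℕ; zero; suc; z≤n; s≤s) renaming (_≤_ to _≤ℕ_; _+_ to _+ℕ_)
open import Data.Nat.Properties using (m≤m+n; m≤n+m) renaming (≤-trans to ≤ℕ-trans)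
open import Data.Product using (∃; ∃₂; _×_; _,_; proj₁; proj₂)
open import Data.Vec using (Vec; _∷_; []; _∷ʳ_; head; last; init; initLast)
open import Function using (_∘_)
open import Relation.Binary.Bundles using (Poset)
open import Relation.Binary.PropositionalEquality using (_≡_; refl; sym; cong)
open import Relation.Binary.Structures using (IsTotalOrder)
import Relation.Binary.Reasoning.PartialOrder as PosetReasoning

applyWithin : {A : Set} → (ℤ → A) → ℕ → List A
applyWithin f N = applyUpTo (f ∘ ℤ.+_) (suc N) ++ applyUpTo (f ∘ ℤ.-[1+_]) N

∈-applyWithin⁺ : {A : Set} (f : ℤ → A) (N : ℕ) (j : ℤ) → ∣ j ∣ ≤ℕ N → f j ∈ applyWithin f N
∈-applyWithin⁺ f N (ℤ.+ n)      n≤N   = ∈-++⁺ˡ (∈-applyUpTo⁺ (f ∘ ℤ.+_) (s≤s n≤N))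
∈-applyWithin⁺ f N ℤ.-[1+ n ]   1+n≤N = ∈-++⁺ʳ _ (∈-applyUpTo⁺ (f ∘ ℤ.-[1+_]) 1+n≤N)

module _ (G : ArchGroup) where
  open ArchGroup G

  abelianGroup : AbelianGroup _ _
  abelianGroup = record { isAbelianGroup = isAbelianGroup }

  poset : Poset _ _ _
  poset = record { isPartialOrder = IsTotalOrder.isPartialOrder isTotalOrder }

  open AbelianGroup abelianGroup using (assoc; comm; identityʳ)
  open AbelianGroupProperties abelianGroup using (xyx⁻¹≈y; //-rightDividesˡ; //-rightDividesʳ)
  open IsTotalOrder isTotalOrder using (antisym) renaming (refl to ≤-refl; trans to ≤-trans)
  open PosetReasoning poset

  +-monoʳ-≤ : ∀ {x y} z → x ≤ y → z + x ≤ z + y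
  +-monoʳ-≤ {x} {y} z x≤y = begin
    z + x ≡⟨ comm z x ⟩
    x + z ≤⟨ +-monoˡ-≤ z x≤y ⟩
    y + z ≡⟨ comm y z ⟩
    z + y ∎

  +-mono-≤ : ∀ {x y u v} → x ≤ y → u ≤ v → x + u ≤ y + v
  +-mono-≤ x≤y u≤v = ≤-trans (+-monoˡ-≤ _ x≤y) (+-monoʳ-≤ _ u≤v)

  +-cancelˡ-≤ : ∀ {x y} z → z + x ≤ z + y → x ≤ y
  +-cancelˡ-≤ {x} {y} z z+x≤z+y = begin
    x           ≡⟨ sym (xyx⁻¹≈y z x) ⟩
    (z + x) - z ≤⟨ +-monoˡ-≤ (- z) z+x≤z+y ⟩
    (z + y) - z ≡⟨ xyx⁻¹≈y z y ⟩
    y           ∎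

  x+y≤z⇒y≤z-x : ∀ {x y z} → x + y ≤ z → y ≤ z - x
  x+y≤z⇒y≤z-x {x} {y} x+y≤z = begin
    y           ≡⟨ sym (xyx⁻¹≈y x y) ⟩
    (x + y) - x ≤⟨ +-monoˡ-≤ (- x) x+y≤z ⟩
    _ - x       ∎

  x≤y+z⇒x-z≤y : ∀ {x y z} → x ≤ y + z → x - z ≤ y
  x≤y+z⇒x-z≤y {x} {y} {z} x≤y+z = begin
    x - z       ≤⟨ +-monoˡ-≤ (- z) x≤y+z ⟩
    (y + z) - z ≡⟨ //-rightDividesʳ z y ⟩
    y           ∎

  0≤x⇒0≤n·x : ∀ {x} n → 0# ≤ x → 0# ≤ n ·ℕ x
  0≤x⇒0≤n·x zero    0≤x = ≤-refl
  0≤x⇒0≤n·x (suc n) 0≤x = begin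
    0#          ≡⟨ sym (identityʳ 0#) ⟩
    0# + 0#     ≤⟨ +-mono-≤ 0≤x (0≤x⇒0≤n·x n 0≤x) ⟩
    suc n ·ℕ _  ∎

  ·ℕ-cancelʳ-≤ : ∀ {x} → 0# < x → ∀ n N → n ·ℕ x ≤ N ·ℕ x → n ≤ℕ N
  ·ℕ-cancelʳ-≤ _ zero N _ = z≤n
  ·ℕ-cancelʳ-≤ {x} (0≤x , 0≢x) (suc n) zero 1+n·x≤0 = ⊥-elim (0≢x (antisym 0≤x x≤0))
    where
    x≤0 : x ≤ 0#
    x≤0 = begin
      x            ≡⟨ sym (identityʳ x) ⟩
      x + 0#       ≤⟨ +-monoʳ-≤ x (0≤x⇒0≤n·x n 0≤x) ⟩
      suc n ·ℕ x   ≤⟨ 1+n·x≤0 ⟩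
      0#           ∎
  ·ℕ-cancelʳ-≤ {x} 0<x (suc n) (suc N) 1+n·x≤1+N·x =
    s≤s (·ℕ-cancelʳ-≤ 0<x n N (+-cancelˡ-≤ x 1+n·x≤1+N·x))

  multiples-boundedAbove : ∀ {x} → 0# < x → ∀ y → ∃ λ N → ∀ n → n ·ℕ x ≤ y → n ≤ℕ N
  multiples-boundedAbove {x} 0<x y =
    let N , y≤N·x = archimedean x y 0<x
    in N , λ n n·x≤y → ·ℕ-cancelʳ-≤ 0<x n N (≤-trans n·x≤y y≤N·x)

  sum : ∀ {n} → Vec Carrier n → Carrier
  sum []       = 0#
  sum (x ∷ xs) = x + sum xs

  sum-∷ʳ : ∀ {n} (xs : Vec Carrier n) y → sum (xs ∷ʳ y) ≡ sum xs + y
  sum-∷ʳ []       y = comm y 0#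
  sum-∷ʳ (x ∷ xs) y = begin-equality
    x + sum (xs ∷ʳ y)   ≡⟨ cong (x +_) (sum-∷ʳ xs y) ⟩
    x + (sum xs + y)    ≡⟨ sym (assoc x (sum xs) y) ⟩
    x + sum xs + y      ∎

  module _ (c m : Carrier) where

    sum-cyc : ∀ {k} (v : Vec Carrier (suc k)) → sum (cyc G c m v) + c ≡ sum v
    sum-cyc (x ∷ xs) = begin-equality
      sum (xs ∷ʳ (x - c)) + c   ≡⟨ cong (_+ c) (sum-∷ʳ xs (x - c)) ⟩
      sum xs + (x - c) + c      ≡⟨ assoc (sum xs) (x - c) c ⟩
      sum xs + (x - c + c)      ≡⟨ cong (sum xs +_) (//-rightDividesˡ c x) ⟩
      sum xs + x                ≡⟨ comm (sum xs) x ⟩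
      x + sum xs                ∎

    sum-cyc⁻¹ : ∀ {k} (v : Vec Carrier (suc k)) → sum (cyc⁻¹ G c m v) ≡ sum v + c
    sum-cyc⁻¹ v = begin-equality
      last v + c + sum (init v)     ≡⟨ comm (last v + c) (sum (init v)) ⟩
      sum (init v) + (last v + c)   ≡⟨ sym (assoc (sum (init v)) (last v) c) ⟩
      sum (init v) + last v + c     ≡⟨ cong (_+ c) (sym (sum-∷ʳ (init v) (last v))) ⟩
      sum (init v ∷ʳ last v) + c    ≡⟨ cong (λ w → sum w + c) (sym (proj₂ (proj₂ (initLast v)))) ⟩
      sum v + c                     ∎

    sum-iterN-cyc : ∀ {k} n (g : Vec Carrier (suc k)) → sum (iterN G c m (cyc G c m) n g) + n ·ℕ c ≡ sum g
    sum-iterN-cyc zero    g = identityʳ (sum g)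
    sum-iterN-cyc (suc n) g = begin-equality
      sum (cyc G c m w) + (c + n ·ℕ c)   ≡⟨ sym (assoc (sum (cyc G c m w)) c (n ·ℕ c)) ⟩
      sum (cyc G c m w) + c + n ·ℕ c     ≡⟨ cong (_+ n ·ℕ c) (sum-cyc w) ⟩
      sum w + n ·ℕ c                     ≡⟨ sum-iterN-cyc n g ⟩
      sum g                              ∎
      where w = iterN G c m (cyc G c m) n g

    sum-iterN-cyc⁻¹ : ∀ {k} n (g : Vec Carrier (suc k)) → sum (iterN G c m (cyc⁻¹ G c m) n g) ≡ sum g + n ·ℕ c
    sum-iterN-cyc⁻¹ zero    g = sym (identityʳ (sum g))
    sum-iterN-cyc⁻¹ (suc n) g = begin-equality
      sum (cyc⁻¹ G c m w)        ≡⟨ sum-cyc⁻¹ w ⟩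
      sum w + c                  ≡⟨ cong (_+ c) (sum-iterN-cyc⁻¹ n g) ⟩
      sum g + n ·ℕ c + c         ≡⟨ assoc (sum g) (n ·ℕ c) c ⟩
      sum g + (n ·ℕ c + c)       ≡⟨ cong (sum g +_) (comm (n ·ℕ c) c) ⟩
      sum g + (c + n ·ℕ c)       ∎
      where w = iterN G c m (cyc⁻¹ G c m) n g

    sum-boundedAbove : ∀ k B → ∃ λ U → ∀ (h : Vec Carrier (suc k)) → IsAreaVector G c m h → head h ≤ B → sum h ≤ U
    sum-boundedAbove zero    B = B , λ { (x ∷ []) _ x≤B → begin
      x + 0#   ≡⟨ identityʳ x ⟩
      x        ≤⟨ x≤B ⟩
      B        ∎ }
    sum-boundedAbove (suc k) B =
      let U , bound = sum-boundedAbove k (B + m)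
      in B + U , λ { (x ∷ y ∷ ys) av x≤B →
           +-mono-≤ x≤B (bound (y ∷ ys) (av ∘ fsuc) (≤-trans (av fzero) (+-monoˡ-≤ m x≤B))) }

    head-sum-boundedBelow : ∀ k A → ∃₂ λ a L → ∀ (h : Vec Carrier (suc k)) → IsAreaVector G c m h → A ≤ last h →
                            a ≤ head h × L ≤ sum h
    head-sum-boundedBelow zero    A = A , A , λ { (x ∷ []) _ A≤x → A≤x , (begin
      A        ≤⟨ A≤x ⟩
      x        ≡⟨ sym (identityʳ x) ⟩
      x + 0#   ∎) }
    head-sum-boundedBelow (suc k) A =
      let a , L , bound = head-sum-boundedBelow k A
      in a - m , a - m + L , λ { (x ∷ y ∷ ys) av A≤last →
           let a≤y , L≤sum = bound (y ∷ ys) (av ∘ fsuc) A≤last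
               a-m≤x       = ≤-trans (+-monoˡ-≤ (- m) a≤y) (x≤y+z⇒x-z≤y (av fzero))
           in a-m≤x , +-mono-≤ a-m≤x L≤sum }

    cycPow⁺-exponent-bounded : 0# < c → ∀ {k} (g : Vec Carrier (suc k)) →
                               ∃ λ N → ∀ n → InS G c m (cycPow G c m (ℤ.+ n) g) → n ≤ℕ N
    cycPow⁺-exponent-bounded 0<c {k} g =
      let _ , L , L≤sum = head-sum-boundedBelow k 0#
          N , bound     = multiples-boundedAbove 0<c (sum g - L)
      in N , λ n (av , _ , 0<last) →
           let L≤sumCⁿg = proj₂ (L≤sum (cycPow G c m (ℤ.+ n) g) av (proj₁ 0<last))
           in bound n (x+y≤z⇒y≤z-x (begin
             L + n ·ℕ c                              ≤⟨ +-monoˡ-≤ (n ·ℕ c) L≤sumCⁿg ⟩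
             sum (cycPow G c m (ℤ.+ n) g) + n ·ℕ c   ≡⟨ sum-iterN-cyc n g ⟩
             sum g                                   ∎))

    cycPow⁻-exponent-bounded : 0# < c → ∀ {k} (g : Vec Carrier (suc k)) →
                               ∃ λ N → ∀ n → InS G c m (cycPow G c m ℤ.-[1+ n ] g) → suc n ≤ℕ N
    cycPow⁻-exponent-bounded 0<c {k} g =
      let U , sum≤U = sum-boundedAbove k c
          N , bound = multiples-boundedAbove 0<c (U - sum g)
      in N , λ n (av , h₀≤c , _) → bound (suc n) (x+y≤z⇒y≤z-x (begin
           sum g + suc n ·ℕ c                ≡⟨ sym (sum-iterN-cyc⁻¹ (suc n) g) ⟩
           sum (cycPow G c m ℤ.-[1+ n ] g)   ≤⟨ sum≤U (cycPow G c m ℤ.-[1+ n ] g) av h₀≤c ⟩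
           U                                 ∎))

    cycPow-exponent-bounded : 0# < c → ∀ {k} (g : Vec Carrier (suc k)) →
                              ∃ λ N → ∀ j → InS G c m (cycPow G c m j g) → ∣ j ∣ ≤ℕ N
    cycPow-exponent-bounded 0<c g =
      let N₊ , bound₊ = cycPow⁺-exponent-bounded 0<c g
          N₋ , bound₋ = cycPow⁻-exponent-bounded 0<c g
      in N₊ +ℕ N₋ , λ where
           (ℤ.+ n)    Cʲg∈S → ≤ℕ-trans (bound₊ n Cʲg∈S) (m≤m+n N₊ N₋)
           ℤ.-[1+ n ] Cʲg∈S → ≤ℕ-trans (bound₋ n Cʲg∈S) (m≤n+m N₋ N₊)

lemma2p12 : (G : ArchGroup) (c m : ArchGroup.Carrier G) → ArchGroup._<_ G (ArchGroup.0# G) c → ArchGroup._≤_ G (ArchGroup.0# G) m → (k : ℕ) → (g : Vec (ArchGroup.Carrier G) (suc k)) → InS G c m g → ClassFinite G c m g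
lemma2p12 G c m 0<c _ k g _ =
  let N , bound = cycPow-exponent-bounded G c m 0<c g
  in applyWithin (λ j → cycPow G c m j g) N ,
     λ { _ (_ , Cʲg∈S , j , refl) → ∈-applyWithin⁺ (λ j → cycPow G c m j g) N j (bound j Cʲg∈S) }
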